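{- Let $m\ge 2$ be an integer, let $i\in\{0,1,2\}$, let $n=3(m-2)+2+i$, let $P_n$ be the path of order $n$, and let $k\ge 0$ be an integer. (1) If $m\ge 3$, then $$\alpha_{k-reg}(P_n)=\begin{cases}\lceil \frac{n-2}{2}\rceil, & \text{if } k=0;\\ n-m, & \text{if } k=1;\\ n-2, & \text{if } k\ge 2.\end{cases}$$ (2) If $m=2$, then $\alpha_{k-reg}(P_2)=1$ if $k=0$ and $\alpha_{k-reg}(P_2)=2$ if $k\ge 1$; moreover $\alpha_{k-reg}(P_3)=\alpha_{k-reg}(P_4)=2$ for all $k\ge 0$.
   Context: All graphs are finite, simple and undirected. For a graph $G$ and an integer $i\ge 0$, $D_i(G)$ denotes the set of vertices of degree $i$ in $G$. For an integer $k\ge 0$, a set $S\subseteq V(G)$ is $k$-independent if the induced subgraph $G[S]$ has maximum degree at most $k$. A regular $k$-independent set is a $k$-independent set $S$ with $S\subseteq D_i(G)$ for some $i$. The regular $k$-independence number $\alpha_{k-reg}(G)$ is the maximum cardinality of a regular $k$-independent set of $G$. -}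

module Defs where

open import Data.Nat using (ℕ; zero; suc; _≤_)
open import Data.Fin using (Fin; toℕ)
open import Data.Fin.Subset using (Subset; _∈_; ∣_∣; _∩_)
open import Data.Vec using (tabulate)
open import Data.Product using (Σ; ∃; _×_)
open import Data.Sum using (_⊎_)
open import Relation.Nullary using (Dec; does; ¬_)
open import Relation.Binary.PropositionalEquality using (_≡_)
open import Data.Fin.Properties using () renaming (_≟_ to _≟ᶠ_)
import Data.Nat.Properties as ℕP
open import Relation.Nullary.Decidable using (_⊎-dec_)

record Graph : Set₁ where
  field
    order : ℕ
    Adj   : Fin order → Fin order → Set
    adj?  : (u v : Fin order) → Dec (Adj u v)
    sym   : ∀ {u v} → Adj u v → Adj v u
    irrefl : ∀ {u} → ¬ Adj u u

module _ (G : Graph) where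
  open Graph G

  N : Fin order → Subset order
  N v = tabulate (λ u → does (adj? v u))

  degree : Fin order → ℕ
  degree v = ∣ N v ∣

  KIndependent : ℕ → Subset order → Set
  KIndependent k S = ∀ v → v ∈ S → ∣ S ∩ N v ∣ ≤ k

  DegreeUniform : Subset order → Set
  DegreeUniform S = Σ ℕ λ i → ∀ v → v ∈ S → degree v ≡ i

  RegularKIndependent : ℕ → Subset order → Set
  RegularKIndependent k S = KIndependent k S × DegreeUniform S

  IsRegKIndepNumber : ℕ → ℕ → Set
  IsRegKIndepNumber k a =
    (Σ (Subset order) λ S → RegularKIndependent k S × ∣ S ∣ ≡ a)
    × (∀ S → RegularKIndependent k S → ∣ S ∣ ≤ a)

PathAdj : ∀ {n} → Fin n → Fin n → Set
PathAdj u v = (toℕ v ≡ suc (toℕ u)) ⊎ (toℕ u ≡ suc (toℕ v))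

private
  pathAdj? : ∀ {n} (u v : Fin n) → Dec (PathAdj u v)
  pathAdj? u v = (toℕ v ℕP.≟ suc (toℕ u)) ⊎-dec (toℕ u ℕP.≟ suc (toℕ v))

  open import Data.Sum using (inj₁; inj₂)
  pathSym : ∀ {n} {u v : Fin n} → PathAdj u v → PathAdj v u
  pathSym (inj₁ p) = inj₂ p
  pathSym (inj₂ p) = inj₁ p

  pathIrr : ∀ {n} {u : Fin n} → ¬ PathAdj u u
  pathIrr {u = u} (inj₁ p) = ℕP.<⇒≢ (ℕP.n<1+n (toℕ u)) p
  pathIrr {u = u} (inj₂ p) = ℕP.<⇒≢ (ℕP.n<1+n (toℕ u)) p

Path : ℕ → Graph
Path n = record
  { order = n ; Adj = PathAdj ; adj? = pathAdj?
  ; sym = pathSym ; irrefl = λ {u} → pathIrr {u = u} }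

-- Write the path P_(L+2) as 0, 1, …, L+1. A regular set either contains an
-- endpoint, and then (being degree-uniform) consists of endpoints only, so it
-- has at most 2 elements; or it lies among the L interior vertices, where it is
-- an arbitrary 0/1 string of length L in which every 1 has at most k
-- neighbouring 1s. For k = 0 such strings have no two adjacent 1s, for k = 1
-- no three consecutive 1s, and for k ≥ 2 they are unrestricted; the strings
-- 1010…, 110110… and 111… attain the resulting bounds ⌈L/2⌉, 2q+i (L = 3q+i)
-- and L. For m ≥ 3 these values are at least 2, so the endpoint sets never win.
module Submission where

open import Defs
open import Data.Bool using (Bool; true; false; _∧_)
open import Data.Nat using (ℕ; zero; suc; _+_; _*_; _∸_; _≤_; _<_; ⌈_/2⌉; z≤n; s≤s)
open import Data.Nat.Properties
open import Data.Fin using (Fin; toℕ) renaming (zero to fzero; suc to fsuc)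
open import Data.Fin.Subset using (Subset; ⊤; _∈_; ∣_∣; _∩_)
open import Data.Fin.Subset.Properties using (∣p∣≤n; ∩-identityˡ)
open import Data.Vec using ([]; _∷_; _∷ʳ_; tabulate; here; there)
open import Data.Product using (∃; _×_; _,_)
open import Data.Sum using (_⊎_; inj₁; inj₂)
open import Data.Empty using (⊥)
open import Function using (_∘_)
open import Relation.Nullary using (contradiction)
open import Relation.Binary.PropositionalEquality

bit : Bool → ℕ
bit true  = 1
bit false = 0

bit≤1 : ∀ b → bit b ≤ 1
bit≤1 true  = s≤s z≤n
bit≤1 false = z≤n

count : (ℕ → Bool) → ℕ → ℕ
count h zero    = 0
count h (suc n) = bit (h 0) + count (h ∘ suc) n

count≤ : ∀ n h → count h n ≤ n
count≤ zero    h = z≤n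
count≤ (suc n) h = +-mono-≤ (bit≤1 (h 0)) (count≤ n (h ∘ suc))

count-snoc : ∀ n h → count h (suc n) ≡ count h n + bit (h n)
count-snoc zero    h = +-identityʳ (bit (h 0))
count-snoc (suc n) h =
  trans (cong (bit (h 0) +_) (count-snoc n (h ∘ suc))) (sym (+-assoc (bit (h 0)) _ _))

count-false : ∀ n h → (∀ j → j < n → h j ≡ false) → count h n ≡ 0
count-false zero    h _ = refl
count-false (suc n) h h≡false rewrite h≡false 0 (s≤s z≤n) =
  count-false n (h ∘ suc) (λ j j<n → h≡false (suc j) (s≤s j<n))

count-true : ∀ n → count (λ _ → true) n ≡ n
count-true zero    = refl
count-true (suc n) = cong suc (count-true n)

-- Position -1 stands for the first endpoint of the path, absent from interior sets.
prev : (ℕ → Bool) → ℕ → Bool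
prev h zero    = false
prev h (suc j) = h j

neighbours : (ℕ → Bool) → ℕ → ℕ
neighbours h j = bit (h (suc j)) + bit (prev h j)

neighbours≤2 : ∀ h j → neighbours h j ≤ 2
neighbours≤2 h j = +-mono-≤ (bit≤1 (h (suc j))) (bit≤1 (prev h j))

Sparse : ℕ → (ℕ → Bool) → Set
Sparse k h = ∀ j → h j ≡ true → neighbours h j ≤ k

_⊑_ : (ℕ → Bool) → (ℕ → Bool) → Set
g ⊑ h = ∀ j → g j ≡ true → h j ≡ true

bit-mono : ∀ x y → (x ≡ true → y ≡ true) → bit x ≤ bit y
bit-mono true  y x⇒y rewrite x⇒y refl = s≤s z≤n
bit-mono false y _   = z≤n

prev-⊑ : ∀ {g h} → g ⊑ h → prev g ⊑ prev h
prev-⊑ g⊑h (suc j) = g⊑h j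

neighbours-⊑ : ∀ {g h} → g ⊑ h → ∀ j → neighbours g j ≤ neighbours h j
neighbours-⊑ {g} {h} g⊑h j =
  +-mono-≤ (bit-mono (g (suc j)) (h (suc j)) (g⊑h (suc j))) (bit-mono (prev g j) (prev h j) (prev-⊑ g⊑h j))

sparse-⊑ : ∀ {k g h} → g ⊑ h → Sparse k h → Sparse k g
sparse-⊑ g⊑h sparse j gj = ≤-trans (neighbours-⊑ g⊑h j) (sparse j (g⊑h j gj))

NoTwoConsecutive : (ℕ → Bool) → Set
NoTwoConsecutive h = ∀ j → h j ≡ true → h (suc j) ≡ true → ⊥

NoThreeConsecutive : (ℕ → Bool) → Set
NoThreeConsecutive h = ∀ j → h j ≡ true → h (suc j) ≡ true → h (suc (suc j)) ≡ true → ⊥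

sparse₀⇒noTwoConsecutive : ∀ {h} → Sparse 0 h → NoTwoConsecutive h
sparse₀⇒noTwoConsecutive {h} sparse j hj hsj =
  contradiction (subst (λ b → bit b + bit (prev h j) ≤ 0) hsj (sparse j hj)) λ ()

sparse₁⇒noThreeConsecutive : ∀ {h} → Sparse 1 h → NoThreeConsecutive h
sparse₁⇒noThreeConsecutive {h} sparse j hj hsj hssj =
  contradiction (subst₂ (λ a b → bit a + bit b ≤ 1) hssj hj (sparse (suc j) hsj)) λ { (s≤s ()) }

*[1+q]+i≡+[*q+i] : ∀ k q i → k * suc q + i ≡ k + (k * q + i)
*[1+q]+i≡+[*q+i] k q i = trans (cong (_+ i) (*-suc k q)) (+-assoc k (k * q) i)

count-noTwoConsecutive : ∀ L h → NoTwoConsecutive h → count h L ≤ ⌈ L /2⌉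
count-noTwoConsecutive zero          h _  = z≤n
count-noTwoConsecutive (suc zero)    h _  = +-mono-≤ (bit≤1 (h 0)) z≤n
count-noTwoConsecutive (suc (suc L)) h no =
  pair (h 0) (h 1) (no 0) (count-noTwoConsecutive L (h ∘ suc ∘ suc) (λ j → no (suc (suc j))))
  where
  pair : ∀ x y {c d} → (x ≡ true → y ≡ true → ⊥) → c ≤ d → bit x + (bit y + c) ≤ suc d
  pair true  true  no-xy _   = contradiction refl (no-xy refl)
  pair true  false _     c≤d = s≤s c≤d
  pair false y     _     c≤d = +-mono-≤ (bit≤1 y) c≤d

count-noThreeConsecutive : ∀ q i h → NoThreeConsecutive h → count h (3 * q + i) ≤ 2 * q + i
count-noThreeConsecutive zero    i h _ = count≤ i h
count-noThreeConsecutive (suc q) i h no =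
  subst₂ (λ n c → count h n ≤ c) (sym (*[1+q]+i≡+[*q+i] 3 q i)) (sym (*[1+q]+i≡+[*q+i] 2 q i))
    (triple (h 0) (h 1) (h 2) (no 0)
      (count-noThreeConsecutive q i (h ∘ suc ∘ suc ∘ suc) (λ j → no (suc (suc (suc j))))))
  where
  triple : ∀ x y z {c d} → (x ≡ true → y ≡ true → z ≡ true → ⊥) → c ≤ d →
           bit x + (bit y + (bit z + c)) ≤ suc (suc d)
  triple true  true  true  no-xyz _   = contradiction refl (no-xyz refl refl)
  triple true  true  false _      c≤d = s≤s (s≤s c≤d)
  triple true  false z     _      c≤d = s≤s (+-mono-≤ (bit≤1 z) c≤d)
  triple false y     z     _      c≤d = +-mono-≤ (bit≤1 y) (+-mono-≤ (bit≤1 z) c≤d)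

alternating : ℕ → Bool
alternating zero          = true
alternating (suc zero)    = false
alternating (suc (suc j)) = alternating j

count-alternating : ∀ L → count alternating L ≡ ⌈ L /2⌉
count-alternating zero          = refl
count-alternating (suc zero)    = refl
count-alternating (suc (suc L)) = cong suc (count-alternating L)

alternating-sparse : Sparse 0 alternating
alternating-sparse zero          _  = z≤n
alternating-sparse (suc (suc j)) hj = subst (_≤ 0) (periodic j) (alternating-sparse j hj)
  where
  periodic : ∀ j → neighbours alternating j ≡ neighbours alternating (suc (suc j))
  periodic zero    = refl
  periodic (suc j) = refl

twoOfThree : ℕ → Bool
twoOfThree zero                = true
twoOfThree (suc zero)          = true
twoOfThree (suc (suc zero))    = false
twoOfThree (suc (suc (suc j))) = twoOfThree j

count-twoOfThree : ∀ q i → i ≤ 2 → count twoOfThree (3 * q + i) ≡ 2 * q + i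
count-twoOfThree zero    zero                _ = refl
count-twoOfThree zero    (suc zero)          _ = refl
count-twoOfThree zero    (suc (suc zero))    _ = refl
count-twoOfThree zero    (suc (suc (suc i))) (s≤s (s≤s ()))
count-twoOfThree (suc q) i i≤2 = begin
  count twoOfThree (3 * suc q + i)   ≡⟨ cong (count twoOfThree) (*[1+q]+i≡+[*q+i] 3 q i) ⟩
  2 + count twoOfThree (3 * q + i)   ≡⟨ cong (2 +_) (count-twoOfThree q i i≤2) ⟩
  2 + (2 * q + i)                    ≡⟨ *[1+q]+i≡+[*q+i] 2 q i ⟨
  2 * suc q + i                      ∎
  where open ≡-Reasoning

twoOfThree-sparse : Sparse 1 twoOfThree
twoOfThree-sparse zero                _  = s≤s z≤n
twoOfThree-sparse (suc zero)          _  = s≤s z≤n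
twoOfThree-sparse (suc (suc (suc j))) hj = subst (_≤ 1) (periodic j) (twoOfThree-sparse j hj)
  where
  periodic : ∀ j → neighbours twoOfThree j ≡ neighbours twoOfThree (suc (suc (suc j)))
  periodic zero    = refl
  periodic (suc j) = refl

at : ∀ {n} → Subset n → ℕ → Bool
at []      j       = false
at (x ∷ S) zero    = x
at (x ∷ S) (suc j) = at S j

at⇒< : ∀ {n} (S : Subset n) j → at S j ≡ true → j < n
at⇒< (x ∷ S) zero    _ = s≤s z≤n
at⇒< (x ∷ S) (suc j) e = s≤s (at⇒< S j e)

at⇒∈ : ∀ {n} (S : Subset n) j → at S j ≡ true → ∃ λ u → toℕ u ≡ j × u ∈ S
at⇒∈ (true ∷ S) zero    _ = fzero , refl , here
at⇒∈ (x ∷ S)    (suc j) e with at⇒∈ S j e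
... | u , refl , u∈S = fsuc u , refl , there u∈S

∈⇒at : ∀ {n} {S : Subset n} {u} → u ∈ S → at S (toℕ u) ≡ true
∈⇒at here      = refl
∈⇒at (there p) = ∈⇒at p

∣b∷S∣ : ∀ {n} b (S : Subset n) → ∣ b ∷ S ∣ ≡ bit b + ∣ S ∣
∣b∷S∣ true  S = refl
∣b∷S∣ false S = refl

∣S∣≡count : ∀ {n} (S : Subset n) → ∣ S ∣ ≡ count (at S) n
∣S∣≡count []      = refl
∣S∣≡count (x ∷ S) = trans (∣b∷S∣ x S) (cong (bit x +_) (∣S∣≡count S))

∣S∷ʳfalse∣ : ∀ {n} (S : Subset n) → ∣ S ∷ʳ false ∣ ≡ ∣ S ∣
∣S∷ʳfalse∣ []         = refl
∣S∷ʳfalse∣ (true ∷ S)  = cong suc (∣S∷ʳfalse∣ S)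
∣S∷ʳfalse∣ (false ∷ S) = ∣S∷ʳfalse∣ S

at-∷ʳfalse : ∀ {n} (S : Subset n) j → at (S ∷ʳ false) j ≡ at S j
at-∷ʳfalse []      zero    = refl
at-∷ʳfalse []      (suc j) = refl
at-∷ʳfalse (x ∷ S) zero    = refl
at-∷ʳfalse (x ∷ S) (suc j) = at-∷ʳfalse S j

fromSeq : ∀ n → (ℕ → Bool) → Subset n
fromSeq n h = tabulate (h ∘ toℕ)

∣fromSeq∣≡count : ∀ n h → ∣ fromSeq n h ∣ ≡ count h n
∣fromSeq∣≡count zero    h = refl
∣fromSeq∣≡count (suc n) h =
  trans (∣b∷S∣ (h 0) (fromSeq n (h ∘ suc))) (cong (bit (h 0) +_) (∣fromSeq∣≡count n (h ∘ suc)))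

at-fromSeq-⊑ : ∀ n h → at (fromSeq n h) ⊑ h
at-fromSeq-⊑ (suc n) h zero    e = e
at-fromSeq-⊑ (suc n) h (suc j) e = at-fromSeq-⊑ n (h ∘ suc) j e

∣S∩∅∣≡0 : ∀ {n} (S : Subset n) → ∣ S ∩ tabulate (λ _ → false) ∣ ≡ 0
∣S∩∅∣≡0 []          = refl
∣S∩∅∣≡0 (true ∷ S)  = ∣S∩∅∣≡0 S
∣S∩∅∣≡0 (false ∷ S) = ∣S∩∅∣≡0 S

∣b∧false∷S∣ : ∀ {n} b (S : Subset n) → ∣ (b ∧ false) ∷ S ∣ ≡ ∣ S ∣
∣b∧false∷S∣ true  S = refl
∣b∧false∷S∣ false S = refl

-- Restricting to the tail, N (Path (suc n)) (fsuc u) is (toℕ u ≡ᵇ 0) ∷ N (Path n) u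
-- definitionally; this drives the induction on u.
∣S∩N∣≡neighbours : ∀ {n} (S : Subset n) u → ∣ S ∩ N (Path n) u ∣ ≡ neighbours (at S) (toℕ u)
∣S∩N∣≡neighbours (s ∷ [])        fzero = ∣b∧false∷S∣ s []
∣S∩N∣≡neighbours (s ∷ true ∷ S)  fzero =
  trans (∣b∧false∷S∣ s (true ∷ S ∩ tabulate (λ _ → false))) (cong suc (∣S∩∅∣≡0 S))
∣S∩N∣≡neighbours (s ∷ false ∷ S) fzero =
  trans (∣b∧false∷S∣ s (false ∷ S ∩ tabulate (λ _ → false))) (∣S∩∅∣≡0 S)
∣S∩N∣≡neighbours (true ∷ S)  (fsuc fzero) =
  trans (cong suc (∣S∩N∣≡neighbours S fzero)) (sym (+-suc (bit (at S 1)) 0))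
∣S∩N∣≡neighbours (false ∷ S) (fsuc fzero)     = ∣S∩N∣≡neighbours S fzero
∣S∩N∣≡neighbours (s ∷ S)     (fsuc (fsuc u)) =
  trans (∣b∧false∷S∣ s (S ∩ N (Path _) (fsuc u))) (∣S∩N∣≡neighbours S (fsuc u))

degree-Path : ∀ {n} (u : Fin n) → degree (Path n) u ≡ neighbours (at (⊤ {n})) (toℕ u)
degree-Path {n} u = trans (cong ∣_∣ (sym (∩-identityˡ (N (Path n) u)))) (∣S∩N∣≡neighbours ⊤ u)

neighbours-⊤-last : ∀ L → neighbours (at (⊤ {suc (suc L)})) (suc L) ≡ 1
neighbours-⊤-last zero    = refl
neighbours-⊤-last (suc L) = neighbours-⊤-last L

neighbours-⊤-interior : ∀ {n} j → suc (suc j) < n → neighbours (at (⊤ {n})) (suc j) ≡ 2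
neighbours-⊤-interior {suc (suc zero)}    zero    (s≤s (s≤s ()))
neighbours-⊤-interior {suc (suc (suc n))} zero    _       = refl
neighbours-⊤-interior {suc n}             (suc j) (s≤s p) = neighbours-⊤-interior j p

degree-first : ∀ L → degree (Path (suc (suc L))) fzero ≡ 1
degree-first L = degree-Path {suc (suc L)} fzero

degree-last : ∀ L (u : Fin (suc (suc L))) → toℕ u ≡ suc L → degree (Path (suc (suc L))) u ≡ 1
degree-last L u u≡last =
  trans (degree-Path u) (trans (cong (neighbours (at (⊤ {suc (suc L)}))) u≡last) (neighbours-⊤-last L))

degree-interior : ∀ {n} (u : Fin n) {j} → toℕ u ≡ suc j → suc (suc j) < n → degree (Path n) u ≡ 2
degree-interior {n} u {j} u≡1+j p =
  trans (degree-Path u) (trans (cong (neighbours (at (⊤ {n}))) u≡1+j) (neighbours-⊤-interior j p))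

uniform-degree : ∀ G {S u d} → DegreeUniform G S → u ∈ S → degree G u ≡ d →
                 ∀ v → v ∈ S → degree G v ≡ d
uniform-degree G (_ , deg) u∈S du v v∈S = trans (deg v v∈S) (trans (sym (deg _ u∈S)) du)

endpoints-only-≤2 : ∀ L (S : Subset (suc (suc L))) →
  (∀ v → v ∈ S → degree (Path (suc (suc L))) v ≡ 1) → ∣ S ∣ ≤ 2
endpoints-only-≤2 L (s ∷ T) only-endpoints = begin
  ∣ s ∷ T ∣                                ≡⟨ ∣b∷S∣ s T ⟩
  bit s + ∣ T ∣                            ≡⟨ cong (bit s +_) (∣S∣≡count T) ⟩
  bit s + count (at T) (suc L)             ≡⟨ cong (bit s +_) (count-snoc L (at T)) ⟩
  bit s + (count (at T) L + bit (at T L))  ≡⟨ cong (λ c → bit s + (c + bit (at T L))) (count-false L (at T) interior-absent) ⟩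
  bit s + bit (at T L)                     ≤⟨ +-mono-≤ (bit≤1 s) (bit≤1 (at T L)) ⟩
  2                                        ∎
  where
  open ≤-Reasoning
  interior-absent : ∀ j → j < L → at T j ≡ false
  interior-absent j j<L with at T j in e
  ... | false = refl
  ... | true with at⇒∈ T j e
  ...   | u , u≡j , u∈T =
    contradiction (trans (sym (degree-interior (fsuc u) (cong suc u≡j) (s≤s (s≤s j<L))))
                         (only-endpoints (fsuc u) (there u∈T))) λ ()

regular-dichotomy : ∀ L k (S : Subset (suc (suc L))) → RegularKIndependent (Path (suc (suc L))) k S →
  ∣ S ∣ ≤ 2 ⊎ ∃ λ h → Sparse k h × ∣ S ∣ ≡ count h L
regular-dichotomy L k (true ∷ T) (_ , uniform) =
  inj₁ (endpoints-only-≤2 L _ (uniform-degree (Path (suc (suc L))) uniform here (degree-first L)))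
regular-dichotomy L k (false ∷ T) (independent , uniform) with at T L in last
... | true with at⇒∈ T L last
...   | u , u≡L , u∈T =
  inj₁ (endpoints-only-≤2 L _ (uniform-degree (Path (suc (suc L))) uniform (there u∈T) (degree-last L (fsuc u) (cong suc u≡L))))
regular-dichotomy L k (false ∷ T) (independent , uniform) | false = inj₂ (at T , interior-sparse , size)
  where
  interior-sparse : Sparse k (at T)
  interior-sparse j Tj with at⇒∈ T j Tj
  ... | u , refl , u∈T = subst (_≤ k) (∣S∩N∣≡neighbours T u) (independent (fsuc u) (there u∈T))
  size : ∣ T ∣ ≡ count (at T) L
  size = trans (∣S∣≡count T) (trans (count-snoc L (at T)) (trans (cong (λ b → count (at T) L + bit b) last) (+-identityʳ _)))

interiorSet : ∀ L → (ℕ → Bool) → Subset (suc (suc L))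
interiorSet L h = false ∷ (fromSeq L h ∷ʳ false)

∣interiorSet∣ : ∀ L h → ∣ interiorSet L h ∣ ≡ count h L
∣interiorSet∣ L h = trans (∣S∷ʳfalse∣ (fromSeq L h)) (∣fromSeq∣≡count L h)

interiorSet-regular : ∀ L k h → Sparse k h → RegularKIndependent (Path (suc (suc L))) k (interiorSet L h)
interiorSet-regular L k h sparse = independent , 2 , interior
  where
  T : Subset (suc L)
  T = fromSeq L h ∷ʳ false
  T-inner : ∀ j → at T j ≡ at (fromSeq L h) j
  T-inner = at-∷ʳfalse (fromSeq L h)
  T⊑h : at T ⊑ h
  T⊑h j Tj = at-fromSeq-⊑ L h j (trans (sym (T-inner j)) Tj)
  independent : KIndependent (Path (suc (suc L))) k (interiorSet L h)
  independent (fsuc u) (there u∈T) =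
    subst (_≤ k) (sym (∣S∩N∣≡neighbours T u)) (sparse-⊑ T⊑h sparse (toℕ u) (∈⇒at u∈T))
  interior : ∀ v → v ∈ interiorSet L h → degree (Path (suc (suc L))) v ≡ 2
  interior (fsuc u) (there u∈T) =
    degree-interior (fsuc u) refl (s≤s (s≤s (at⇒< (fromSeq L h) (toℕ u) (trans (sym (T-inner (toℕ u))) (∈⇒at u∈T)))))

regIndepNumber-Path : ∀ L k α → 2 ≤ α → (∃ λ h → Sparse k h × count h L ≡ α) →
  (∀ h → Sparse k h → count h L ≤ α) → IsRegKIndepNumber (Path (suc (suc L))) k α
regIndepNumber-Path L k α 2≤α (h , sparse , count≡α) maximal =
  (interiorSet L h , interiorSet-regular L k h sparse , trans (∣interiorSet∣ L h) count≡α) , bounded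
  where
  bounded : ∀ S → RegularKIndependent (Path (suc (suc L))) k S → ∣ S ∣ ≤ α
  bounded S regular with regular-dichotomy L k S regular
  ... | inj₁ ∣S∣≤2                   = ≤-trans ∣S∣≤2 2≤α
  ... | inj₂ (h′ , sparse′ , ∣S∣≡) = subst (_≤ α) (sym ∣S∣≡) (maximal h′ sparse′)

regIndep₀-Path : ∀ L → 3 ≤ L → IsRegKIndepNumber (Path (suc (suc L))) 0 ⌈ L /2⌉
regIndep₀-Path L 3≤L =
  regIndepNumber-Path L 0 ⌈ L /2⌉ (⌈n/2⌉-mono 3≤L) (alternating , alternating-sparse , count-alternating L)
    (λ h sparse → count-noTwoConsecutive L h (sparse₀⇒noTwoConsecutive sparse))

regIndep₁-Path : ∀ q i → 1 ≤ q → i ≤ 2 → IsRegKIndepNumber (Path (suc (suc (3 * q + i)))) 1 (2 * q + i)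
regIndep₁-Path q i 1≤q i≤2 =
  regIndepNumber-Path (3 * q + i) 1 (2 * q + i) (≤-trans (*-monoʳ-≤ 2 1≤q) (m≤m+n (2 * q) i))
    (twoOfThree , twoOfThree-sparse , count-twoOfThree q i i≤2)
    (λ h sparse → count-noThreeConsecutive q i h (sparse₁⇒noThreeConsecutive sparse))

regIndep≥2-Path : ∀ L k → 2 ≤ L → 2 ≤ k → IsRegKIndepNumber (Path (suc (suc L))) k L
regIndep≥2-Path L k 2≤L 2≤k =
  regIndepNumber-Path L k L 2≤L ((λ _ → true) , (λ j _ → ≤-trans (neighbours≤2 (λ _ → true) j) 2≤k) , count-true L)
    (λ h _ → count≤ L h)

regular≤2-shortPath : ∀ L k → L ≤ 2 → ∀ S → RegularKIndependent (Path (suc (suc L))) k S → ∣ S ∣ ≤ 2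
regular≤2-shortPath L k L≤2 S regular with regular-dichotomy L k S regular
... | inj₁ ∣S∣≤2             = ∣S∣≤2
... | inj₂ (h , _ , ∣S∣≡) = subst (_≤ 2) (sym ∣S∣≡) (≤-trans (count≤ L h) L≤2)

regIndep₀-P₂ : IsRegKIndepNumber (Path 2) 0 1
regIndep₀-P₂ = (true ∷ false ∷ [] , (independent , 1 , endpoint) , refl) , bounded
  where
  independent : KIndependent (Path 2) 0 (true ∷ false ∷ [])
  independent fzero _ = z≤n
  independent (fsuc fzero) (there ())
  endpoint : ∀ v → v ∈ (true ∷ false ∷ []) → degree (Path 2) v ≡ 1
  endpoint fzero _ = refl
  endpoint (fsuc fzero) (there ())
  bounded : ∀ S → RegularKIndependent (Path 2) 0 S → ∣ S ∣ ≤ 1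
  bounded (true  ∷ true  ∷ []) (independent′ , _) = contradiction (independent′ fzero here) λ ()
  bounded (true  ∷ false ∷ []) _ = s≤s z≤n
  bounded (false ∷ true  ∷ []) _ = s≤s z≤n
  bounded (false ∷ false ∷ []) _ = z≤n

regIndep-P₂ : ∀ k → 1 ≤ k → IsRegKIndepNumber (Path 2) k 2
regIndep-P₂ k 1≤k = (⊤ , (independent , 1 , endpoint) , refl) , (λ S _ → ∣p∣≤n S)
  where
  independent : KIndependent (Path 2) k ⊤
  independent fzero        _ = 1≤k
  independent (fsuc fzero) _ = 1≤k
  endpoint : ∀ v → v ∈ ⊤ → degree (Path 2) v ≡ 1
  endpoint fzero        _ = refl
  endpoint (fsuc fzero) _ = refl

regIndep-P₃ : ∀ k → IsRegKIndepNumber (Path 3) k 2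
regIndep-P₃ k = (ends , (independent , 1 , endpoint) , refl) , regular≤2-shortPath 1 k (s≤s z≤n)
  where
  ends : Subset 3
  ends = true ∷ false ∷ true ∷ []
  independent : KIndependent (Path 3) k ends
  independent fzero               _ = z≤n
  independent (fsuc fzero)        (there ())
  independent (fsuc (fsuc fzero)) _ = z≤n
  endpoint : ∀ v → v ∈ ends → degree (Path 3) v ≡ 1
  endpoint fzero               _ = refl
  endpoint (fsuc fzero)        (there ())
  endpoint (fsuc (fsuc fzero)) _ = refl

regIndep-P₄ : ∀ k → IsRegKIndepNumber (Path 4) k 2
regIndep-P₄ k = (ends , (independent , 1 , endpoint) , refl) , regular≤2-shortPath 2 k (s≤s (s≤s z≤n))
  where
  ends : Subset 4
  ends = true ∷ false ∷ false ∷ true ∷ []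
  independent : KIndependent (Path 4) k ends
  independent fzero                      _ = z≤n
  independent (fsuc fzero)               (there ())
  independent (fsuc (fsuc fzero))        (there (there ()))
  independent (fsuc (fsuc (fsuc fzero))) _ = z≤n
  endpoint : ∀ v → v ∈ ends → degree (Path 4) v ≡ 1
  endpoint fzero                      _ = refl
  endpoint (fsuc fzero)               (there ())
  endpoint (fsuc (fsuc fzero))        (there (there ()))
  endpoint (fsuc (fsuc (fsuc fzero))) _ = refl

a+2+b≡2+[a+b] : ∀ a b → a + 2 + b ≡ 2 + (a + b)
a+2+b≡2+[a+b] a b = trans (+-assoc a 2 b) (trans (+-suc a (suc b)) (cong suc (+-suc a b)))

proposition2p3 : ∀ (m i n k : ℕ) → 2 ≤ m → i ≤ 2 → n ≡ 3 * (m ∸ 2) + 2 + i →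
    (3 ≤ m →
      (k ≡ 0 → IsRegKIndepNumber (Path n) k ⌈ (n ∸ 2) /2⌉)
      × (k ≡ 1 → IsRegKIndepNumber (Path n) k (n ∸ m))
      × (2 ≤ k → IsRegKIndepNumber (Path n) k (n ∸ 2)))
    × (m ≡ 2 →
      (k ≡ 0 → IsRegKIndepNumber (Path 2) k 1)
      × (1 ≤ k → IsRegKIndepNumber (Path 2) k 2)
      × IsRegKIndepNumber (Path 3) k 2
      × IsRegKIndepNumber (Path 4) k 2)
proposition2p3 (suc (suc q)) i n k (s≤s (s≤s z≤n)) i≤2 refl rewrite a+2+b≡2+[a+b] (3 * q) i =
  (λ { (s≤s (s≤s 1≤q)) →
         (λ { refl → regIndep₀-Path L (3≤L 1≤q) })
       , (λ { refl → subst (IsRegKIndepNumber (Path (2 + L)) 1) (sym L∸q≡2q+i) (regIndep₁-Path q i 1≤q i≤2) })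
       , (λ 2≤k → regIndep≥2-Path L k (≤-trans (s≤s (s≤s z≤n)) (3≤L 1≤q)) 2≤k) })
  , λ _ → (λ { refl → regIndep₀-P₂ }) , regIndep-P₂ k , regIndep-P₃ k , regIndep-P₄ k
  where
  L : ℕ
  L = 3 * q + i
  3≤L : 1 ≤ q → 3 ≤ L
  3≤L 1≤q = ≤-trans (*-monoʳ-≤ 3 1≤q) (m≤m+n (3 * q) i)
  L∸q≡2q+i : L ∸ q ≡ 2 * q + i
  L∸q≡2q+i = trans (cong (_∸ q) (+-assoc q (2 * q) i)) (m+n∸m≡n q (2 * q + i))
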